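{- Let $a,b,c,d,n\in\mathbb{N}$ and put $M=8n+a+b+c+d$. Then $$t(a,b,c,d;n)=\sum_{(e_1,e_2,e_3,e_4)\in\{0,1\}^4}(-1)^{e_1+e_2+e_3+e_4}\,N\big(4^{e_1}a,\,4^{e_2}b,\,4^{e_3}c,\,4^{e_4}d;\,M\big).$$ (Explicitly: $t(a,b,c,d;n)=N(a,b,c,d;M)-N(a,b,c,4d;M)-N(a,b,4c,d;M)+N(a,b,4c,4d;M)-N(a,4b,c,d;M)+N(a,4b,c,4d;M)+N(a,4b,4c,d;M)-N(a,4b,4c,4d;M)-N(4a,b,c,d;M)+N(4a,b,c,4d;M)+N(4a,b,4c,d;M)-N(4a,b,4c,4d;M)+N(4a,4b,c,d;M)-N(4a,4b,c,4d;M)-N(4a,4b,4c,d;M)+N(4a,4b,4c,4d;M)$.)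
   Context: $\mathbb{N}$ denotes the set of positive integers. For positive integers $a,b,c,d$ and an integer $m\ge0$, $N(a,b,c,d;m)$ is the number of $(x,y,z,w)\in\mathbb{Z}^4$ with $m = ax^2+by^2+cz^2+dw^2$, and $t(a,b,c,d;m)$ is the number of $(x,y,z,w)\in\mathbb{Z}^4$ with $m = a\frac{x(x-1)}{2}+b\frac{y(y-1)}{2}+c\frac{z(z-1)}{2}+d\frac{w(w-1)}{2}$. -}

module Defs where

open import Data.Nat as ℕ using (ℕ; zero; suc)
open import Data.Integer as ℤ using (ℤ; +_; -_; _*_; _+_; _-_)
open import Data.List using (List; []; _∷_; map; concatMap; length; filter; upTo)
open import Relation.Nullary.Decidable using (Dec)
open import Relation.Binary.PropositionalEquality using (_≡_)
open import Data.Product using (_×_; _,_)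

range : ℕ → List ℤ
range k = map (λ i → + i - + k) (upTo (2 ℕ.* k ℕ.+ 1))

box4 : ℕ → List (ℤ × ℤ × ℤ × ℤ)
box4 k = concatMap (λ x → concatMap (λ y → concatMap (λ z → map (λ w → (x , y , z , w))
           (range k)) (range k)) (range k)) (range k)


quadVal : ℕ → ℕ → ℕ → ℕ → ℤ × ℤ × ℤ × ℤ → ℤ
quadVal a b c d (x , y , z , w) = + a * (x * x) + + b * (y * y) + + c * (z * z) + + d * (w * w)

twiceTriVal : ℕ → ℕ → ℕ → ℕ → ℤ × ℤ × ℤ × ℤ → ℤ
twiceTriVal a b c d (x , y , z , w) =
  + a * (x * (x - + 1)) + + b * (y * (y - + 1)) + + c * (z * (z - + 1)) + + d * (w * (w - + 1))

-- N(a,b,c,d;m): number of (x,y,z,w) ∈ ℤ^4 with m = a x²+b y²+c z²+d w².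
-- For positive a,b,c,d every solution has |x|,|y|,|z|,|w| ≤ m, so counting in [-m,m]^4 counts all of ℤ^4.
N : ℕ → ℕ → ℕ → ℕ → ℕ → ℕ
N a b c d m = length (filter (λ q → quadVal a b c d q ℤ.≟ + m) (box4 m))

-- t(a,b,c,d;m): number of (x,y,z,w) ∈ ℤ^4 with m = a x(x-1)/2 + ... + d w(w-1)/2.
-- For positive coefficients every solution has x(x-1)/2 ≤ m, hence |x| ≤ m+1, so [-(m+1),m+1]^4 suffices.
t : ℕ → ℕ → ℕ → ℕ → ℕ → ℕ
t a b c d m = length (filter (λ q → twiceTriVal a b c d q ℤ.≟ + (2 ℕ.* m)) (box4 (suc m)))

-- Substituting x = 2y - 1 turns a y(y-1)/2 into (a x² - a)/8, so t(a,b,c,d;n) counts the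
-- representations of M = 8n + a + b + c + d by a x² + b y² + c z² + d w² with x, y, z, w all odd.
-- Summing over the odd integers is summing over all integers minus summing over the even ones,
-- and an even x = 2y turns a x² into 4a y²; expanding this in each of the four coordinates
-- gives the sixteen signed terms. Every count is a finite sum over a box, and the bounds on
-- the solutions let all these sums be taken over one box [-M, M]⁴.
module Submission where

open import Defs
open import Data.Nat as ℕ using (ℕ; _*_; NonZero)
open import Data.Integer using (ℤ; +_; _+_; _-_)
open import Relation.Binary.PropositionalEquality using (_≡_)

open import Data.Bool using (Bool; true; false; if_then_else_)
open import Data.Integer as ℤ using (-[1+_]; 0ℤ; ∣_∣)
import Data.Integer.Properties as ℤₚ
open import Data.Integer.Tactic.RingSolver using (solve-∀)
open import Data.List as List using (List; []; _∷_; _++_; _∷ʳ_; upTo; concatMap)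
import Data.List.Properties as Listₚ
open import Data.Nat using (zero; suc; _≤_; _<_; _≤′_; ≤′-refl; ≤′-step; s≤s; z≤n)
import Data.Nat.Properties as ℕₚ
import Data.Nat.Tactic.RingSolver as ℕ-Solver
open import Data.Product using (_×_; _,_)
open import Data.Vec as Vec using (Vec; []; _∷_; zipWith)
open import Data.Vec.Relation.Unary.All using (All; []; _∷_)
open import Data.Vec.Relation.Unary.Any as Any using (Any; here; there)
open import Function using (_∘_; id; _⇔_; mk⇔; Equivalence)
open import Relation.Binary.PropositionalEquality using (refl; sym; trans; cong; cong₂; module ≡-Reasoning)
open import Relation.Nullary using (Dec; does; ¬_)
open import Relation.Nullary.Decidable using (map′; does-≡; dec-false)
open import Relation.Unary using (Decidable)

open ≡-Reasoning

𝟙 : {P : Set} → Dec P → ℤ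
𝟙 P? = if does P? then + 1 else 0ℤ

𝟙-⇔ : {P Q : Set} (P? : Dec P) (Q? : Dec Q) → P ⇔ Q → 𝟙 P? ≡ 𝟙 Q?
𝟙-⇔ P? Q? P⇔Q = cong (λ b → if b then + 1 else 0ℤ) (does-≡ P? (map′ from to Q?))
  where open Equivalence P⇔Q

𝟙-no : {P : Set} (P? : Dec P) → ¬ P → 𝟙 P? ≡ 0ℤ
𝟙-no P? ¬p = cong (λ b → if b then + 1 else 0ℤ) (dec-false P? ¬p)

𝟙-≟-pos : ∀ {i a} m → i ≡ + a → 𝟙 (i ℤ.≟ + m) ≡ 𝟙 (a ℕ.≟ m)
𝟙-≟-pos {i} {a} m i≡+a = 𝟙-⇔ (i ℤ.≟ + m) (a ℕ.≟ m)
  (mk⇔ (λ eq → ℤₚ.+-injective (trans (sym i≡+a) eq)) (λ eq → trans i≡+a (cong +_ eq)))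

∑ : {A : Set} → List A → (A → ℤ) → ℤ
∑ []       f = 0ℤ
∑ (x ∷ xs) f = f x + ∑ xs f

∑-++ : {A : Set} (xs ys : List A) (f : A → ℤ) → ∑ (xs ++ ys) f ≡ ∑ xs f + ∑ ys f
∑-++ []       ys f = sym (ℤₚ.+-identityˡ (∑ ys f))
∑-++ (x ∷ xs) ys f = trans (cong (_+_ (f x)) (∑-++ xs ys f)) (sym (ℤₚ.+-assoc (f x) _ _))

∑-map : {A B : Set} (g : A → B) (xs : List A) (f : B → ℤ) → ∑ (List.map g xs) f ≡ ∑ xs (f ∘ g)
∑-map g []       f = refl
∑-map g (x ∷ xs) f = cong (_+_ (f (g x))) (∑-map g xs f)

∑-concatMap : {A B : Set} (g : A → List B) (xs : List A) (f : B → ℤ) →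
              ∑ (concatMap g xs) f ≡ ∑ xs (λ x → ∑ (g x) f)
∑-concatMap g []       f = refl
∑-concatMap g (x ∷ xs) f = trans (∑-++ (g x) _ f) (cong (_+_ (∑ (g x) f)) (∑-concatMap g xs f))

length-filter≡∑𝟙 : {A : Set} {P : A → Set} (P? : Decidable P) (xs : List A) →
                + List.length (List.filter P? xs) ≡ ∑ xs (𝟙 ∘ P?)
length-filter≡∑𝟙 P? []       = refl
length-filter≡∑𝟙 P? (x ∷ xs) with does (P? x)
... | true  = cong (_+_ (+ 1)) (length-filter≡∑𝟙 P? xs)
... | false = trans (length-filter≡∑𝟙 P? xs) (sym (ℤₚ.+-identityˡ _))

symSum : ℕ → (ℤ → ℤ) → ℤ
symSum zero    f = f 0ℤ
symSum (suc k) f = f -[1+ k ] + symSum k f + f (+ suc k)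

symSum-cong : ∀ k {f g : ℤ → ℤ} → (∀ x → f x ≡ g x) → symSum k f ≡ symSum k g
symSum-cong zero    f≗g = f≗g 0ℤ
symSum-cong (suc k) f≗g = cong₂ _+_ (cong₂ _+_ (f≗g _) (symSum-cong k f≗g)) (f≗g _)

symSum-zero : ∀ k {f : ℤ → ℤ} → (∀ x → f x ≡ 0ℤ) → symSum k f ≡ 0ℤ
symSum-zero zero    f≗0 = f≗0 0ℤ
symSum-zero (suc k) f≗0 = cong₂ _+_ (cong₂ _+_ (f≗0 _) (symSum-zero k f≗0)) (f≗0 _)

symSum-− : ∀ k (f g : ℤ → ℤ) → symSum k (λ x → f x - g x) ≡ symSum k f - symSum k g
symSum-− zero    f g = refl
symSum-− (suc k) f g =
  trans (cong (λ s → f -[1+ k ] - g -[1+ k ] + s + (f (+ suc k) - g (+ suc k))) (symSum-− k f g))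
        (regroup (f -[1+ k ]) (g -[1+ k ]) (symSum k f) (symSum k g) (f (+ suc k)) (g (+ suc k)))
  where
  regroup : ∀ a a′ s s′ b b′ → a - a′ + (s - s′) + (b - b′) ≡ a + s + b - (a′ + s′ + b′)
  regroup = solve-∀

range-suc : ∀ k → range (suc k) ≡ -[1+ k ] ∷ (range k ∷ʳ + suc k)
range-suc k = begin
  List.map h′ (upTo (2 * suc k ℕ.+ 1))
    ≡⟨ cong (List.map h′ ∘ upTo ∘ (ℕ._+ 1)) (ℕₚ.*-suc 2 k) ⟩
  h′ 0 ∷ List.map h′ (List.applyUpTo suc (suc u))
    ≡⟨ cong (λ xs → h′ 0 ∷ List.map h′ xs) (sym (Listₚ.map-upTo suc (suc u))) ⟩
  h′ 0 ∷ List.map h′ (List.map suc (upTo (suc u)))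
    ≡⟨ cong (h′ 0 ∷_) (sym (Listₚ.map-∘ (upTo (suc u)))) ⟩
  h′ 0 ∷ List.map (h′ ∘ suc) (upTo (suc u))
    ≡⟨ cong (h′ 0 ∷_) (Listₚ.map-cong shift (upTo (suc u))) ⟩
  h′ 0 ∷ List.map h (upTo (suc u))
    ≡⟨ cong (λ xs → h′ 0 ∷ List.map h xs) (sym (Listₚ.upTo-∷ʳ u)) ⟩
  h′ 0 ∷ List.map h (upTo u ∷ʳ u)
    ≡⟨ cong (h′ 0 ∷_) (Listₚ.map-++ h (upTo u) _) ⟩
  -[1+ k ] ∷ (range k ∷ʳ h u)
    ≡⟨ cong (λ x → -[1+ k ] ∷ (range k ∷ʳ x)) last ⟩
  -[1+ k ] ∷ (range k ∷ʳ + suc k)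
    ∎
  where
  u = 2 * k ℕ.+ 1
  h h′ : ℕ → ℤ
  h  i = + i - + k
  h′ i = + i - + suc k
  shift : ∀ i → h′ (suc i) ≡ h i
  shift i = trans (ℤₚ.[+m]-[+n]≡m⊖n (suc i) (suc k))
           (trans (ℤₚ.[1+m]⊖[1+n]≡m⊖n i k) (sym (ℤₚ.[+m]-[+n]≡m⊖n i k)))
  last : h u ≡ + suc k
  last = begin
    + (2 * k ℕ.+ 1) - + k         ≡⟨ cong (_- + k) (trans (ℤₚ.pos-+ (2 * k) 1) (cong (_+ + 1) (ℤₚ.pos-* 2 k))) ⟩
    + 2 ℤ.* + k + + 1 - + k       ≡⟨ simplify (+ k) ⟩
    + 1 + + k                     ∎
    where
    simplify : ∀ K → + 2 ℤ.* K + + 1 - K ≡ + 1 + K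
    simplify = solve-∀

∑-range : ∀ k f → ∑ (range k) f ≡ symSum k f
∑-range zero    f = ℤₚ.+-identityʳ (f 0ℤ)
∑-range (suc k) f = begin
  ∑ (range (suc k)) f                                  ≡⟨ cong (λ xs → ∑ xs f) (range-suc k) ⟩
  f -[1+ k ] + ∑ (range k ∷ʳ + suc k) f               ≡⟨ cong (_+_ (f -[1+ k ])) (∑-++ (range k) _ f) ⟩
  f -[1+ k ] + (∑ (range k) f + (f (+ suc k) + 0ℤ))
    ≡⟨ cong (λ s → f -[1+ k ] + (s + (f (+ suc k) + 0ℤ))) (∑-range k f) ⟩
  f -[1+ k ] + (symSum k f + (f (+ suc k) + 0ℤ))     ≡⟨ regroup (f -[1+ k ]) (symSum k f) (f (+ suc k)) ⟩
  symSum (suc k) f                                     ∎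
  where
  regroup : ∀ a s b → a + (s + (b + 0ℤ)) ≡ a + s + b
  regroup = solve-∀

SupportedIn : ℕ → (ℤ → ℤ) → Set
SupportedIn k f = ∀ x → k < ∣ x ∣ → f x ≡ 0ℤ

symSum-extend : ∀ {k k′ f} → SupportedIn k f → k ≤ k′ → symSum k′ f ≡ symSum k f
symSum-extend {k} {f = f} supp k≤k′ = go (ℕₚ.≤⇒≤′ k≤k′)
  where
  go : ∀ {k′} → k ≤′ k′ → symSum k′ f ≡ symSum k f
  go ≤′-refl                 = refl
  go (≤′-step {k′} k≤′k′) = begin
    f -[1+ k′ ] + symSum k′ f + f (+ suc k′)
      ≡⟨ cong₂ (λ l r → l + symSum k′ f + r) (supp _ k<1+k′) (supp _ k<1+k′) ⟩
    0ℤ + symSum k′ f + 0ℤ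
      ≡⟨ trans (ℤₚ.+-identityʳ _) (ℤₚ.+-identityˡ _) ⟩
    symSum k′ f
      ≡⟨ go k≤′k′ ⟩
    symSum k f
      ∎
    where k<1+k′ = s≤s (ℕₚ.≤′⇒≤ k≤′k′)

dbl : ℤ → ℤ
dbl x = x + x

dbl-1 : ℤ → ℤ
dbl-1 x = x + x - + 1

symSum-parity : ∀ k f →
  symSum (suc (k ℕ.+ k)) f ≡ symSum k (f ∘ dbl) + symSum k (f ∘ dbl-1) + f (+ suc (k ℕ.+ k))
symSum-parity zero    f = regroup (f -[1+ 0 ]) (f 0ℤ) (f (+ 1))
  where
  regroup : ∀ a b c → a + b + c ≡ b + a + c
  regroup = solve-∀
-- Unfolding at suc k leaves k + suc k and k + k + 0 in the bound and in dbl, dbl-1 at ±(k+1);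
-- the rewrites normalise both to expressions in k + k.
symSum-parity (suc k) f rewrite ℕₚ.+-suc k k | ℕₚ.+-identityʳ (k ℕ.+ k) =
  trans (cong (λ s → f -[1+ suc (suc j) ] + (f -[1+ suc j ] + s + f (+ suc (suc j))) + f (+ suc (suc (suc j))))
              (symSum-parity k f))
        (regroup (f -[1+ suc (suc j) ]) (f -[1+ suc j ]) (f (+ suc (suc j))) (f (+ suc (suc (suc j))))
                 (symSum k (f ∘ dbl)) (symSum k (f ∘ dbl-1)) (f (+ suc j)))
  where
  j = k ℕ.+ k
  regroup : ∀ a b c d e o g → a + (b + (e + o + g) + c) + d ≡ b + e + c + (a + o + g) + d
  regroup = solve-∀

symSum-dbl-1 : ∀ {k f} → SupportedIn k f → symSum k (f ∘ dbl-1) ≡ symSum k f - symSum k (f ∘ dbl)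
symSum-dbl-1 {k} {f} supp = begin
  O                                ≡⟨ regroup D O ⟩
  D + O + 0ℤ - D                   ≡⟨ cong (λ z → D + O + z - D) (sym (supp (+ suc (k ℕ.+ k)) k<1+2k)) ⟩
  D + O + f (+ suc (k ℕ.+ k)) - D  ≡⟨ cong (_- D) (sym (symSum-parity k f)) ⟩
  symSum (suc (k ℕ.+ k)) f - D     ≡⟨ cong (_- D) (symSum-extend supp (ℕₚ.<⇒≤ k<1+2k)) ⟩
  symSum k f - D                   ∎
  where
  D = symSum k (f ∘ dbl)
  O = symSum k (f ∘ dbl-1)
  k<1+2k = s≤s (ℕₚ.m≤m+n k k)
  regroup : ∀ d o → o ≡ d + o + 0ℤ - d
  regroup = solve-∀

boxSum : ∀ n → ℕ → (Vec ℤ n → ℤ) → ℤ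
boxSum zero    k G = G []
boxSum (suc n) k G = symSum k (λ x → boxSum n k (G ∘ (x ∷_)))

boxSum-cong : ∀ n k {G H : Vec ℤ n → ℤ} → (∀ v → G v ≡ H v) → boxSum n k G ≡ boxSum n k H
boxSum-cong zero    k G≗H = G≗H []
boxSum-cong (suc n) k G≗H = symSum-cong k (λ x → boxSum-cong n k (G≗H ∘ (x ∷_)))

boxSum-zero : ∀ n k {G : Vec ℤ n → ℤ} → (∀ v → G v ≡ 0ℤ) → boxSum n k G ≡ 0ℤ
boxSum-zero zero    k G≗0 = G≗0 []
boxSum-zero (suc n) k G≗0 = symSum-zero k (λ x → boxSum-zero n k (G≗0 ∘ (x ∷_)))

SupportedInBox : ∀ {n} → ℕ → (Vec ℤ n → ℤ) → Set
SupportedInBox k G = ∀ v → Any (λ x → k < ∣ x ∣) v → G v ≡ 0ℤ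

slice-supported : ∀ n {k k′} {G : Vec ℤ (suc n) → ℤ} (h : Vec ℤ n → Vec ℤ n) →
                  SupportedInBox k G → SupportedIn k (λ x → boxSum n k′ (λ v → G (x ∷ h v)))
slice-supported n {k′ = k′} h supp x k<∣x∣ = boxSum-zero n k′ (λ v → supp (x ∷ h v) (here k<∣x∣))

boxSum-extend : ∀ n {k k′} {G : Vec ℤ n → ℤ} → SupportedInBox k G → k ≤ k′ → boxSum n k′ G ≡ boxSum n k G
boxSum-extend zero                   supp k≤k′ = refl
boxSum-extend (suc n) {k} {k′} {G} supp k≤k′ = begin
  symSum k′ (λ x → boxSum n k′ (G ∘ (x ∷_)))
    ≡⟨ symSum-cong k′ (λ x → boxSum-extend n (λ v → supp (x ∷ v) ∘ there) k≤k′) ⟩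
  symSum k′ (λ x → boxSum n k (G ∘ (x ∷_)))
    ≡⟨ symSum-extend (slice-supported n id supp) k≤k′ ⟩
  symSum k (λ x → boxSum n k (G ∘ (x ∷_)))
    ∎

alternatingSum : ∀ n → (Vec Bool n → ℤ) → ℤ
alternatingSum zero    F = F []
alternatingSum (suc n) F = alternatingSum n (F ∘ (false ∷_)) - alternatingSum n (F ∘ (true ∷_))

alternatingSum-cong : ∀ n {F G : Vec Bool n → ℤ} → (∀ e → F e ≡ G e) → alternatingSum n F ≡ alternatingSum n G
alternatingSum-cong zero    F≗G = F≗G []
alternatingSum-cong (suc n) F≗G =
  cong₂ _-_ (alternatingSum-cong n (F≗G ∘ (false ∷_))) (alternatingSum-cong n (F≗G ∘ (true ∷_)))

alternatingSum-− : ∀ n (F G : Vec Bool n → ℤ) →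
                   alternatingSum n (λ e → F e - G e) ≡ alternatingSum n F - alternatingSum n G
alternatingSum-− zero    F G = refl
alternatingSum-− (suc n) F G =
  trans (cong₂ _-_ (alternatingSum-− n _ _) (alternatingSum-− n _ _))
        (regroup (alternatingSum n (F ∘ (false ∷_))) (alternatingSum n (G ∘ (false ∷_)))
                 (alternatingSum n (F ∘ (true ∷_))) (alternatingSum n (G ∘ (true ∷_))))
  where
  regroup : ∀ a b c d → a - b - (c - d) ≡ a - c - (b - d)
  regroup = solve-∀

symSum-alternatingSum : ∀ k n (F : ℤ → Vec Bool n → ℤ) →
                        symSum k (λ x → alternatingSum n (F x)) ≡ alternatingSum n (λ e → symSum k (λ x → F x e))
symSum-alternatingSum k zero    F = refl
symSum-alternatingSum k (suc n) F =
  trans (symSum-− k _ _) (cong₂ _-_ (symSum-alternatingSum k n _) (symSum-alternatingSum k n _))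

dblWhere : ∀ {n} → Vec Bool n → Vec ℤ n → Vec ℤ n
dblWhere = zipWith (λ e x → if e then dbl x else x)

boxSum-dbl-1 : ∀ n {k} {G : Vec ℤ n → ℤ} → SupportedInBox k G →
               boxSum n k (G ∘ Vec.map dbl-1) ≡ alternatingSum n (λ e → boxSum n k (G ∘ dblWhere e))
boxSum-dbl-1 zero            supp = refl
boxSum-dbl-1 (suc n) {k} {G} supp = begin
  symSum k (λ x → boxSum n k (λ v → G (dbl-1 x ∷ Vec.map dbl-1 v)))
    ≡⟨ symSum-cong k (λ x → boxSum-dbl-1 n (λ v → supp (dbl-1 x ∷ v) ∘ there)) ⟩
  symSum k (λ x → alternatingSum n (λ e → slice e (dbl-1 x)))
    ≡⟨ symSum-alternatingSum k n _ ⟩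
  alternatingSum n (λ e → symSum k (slice e ∘ dbl-1))
    ≡⟨ alternatingSum-cong n (λ e → symSum-dbl-1 (slice-supported n (dblWhere e) supp)) ⟩
  alternatingSum n (λ e → symSum k (slice e) - symSum k (slice e ∘ dbl))
    ≡⟨ alternatingSum-− n _ _ ⟩
  alternatingSum (suc n) (λ e → boxSum (suc n) k (G ∘ dblWhere e))
    ∎
  where
  slice : Vec Bool n → ℤ → ℤ
  slice e x = boxSum n k (λ v → G (x ∷ dblWhere e v))

diagForm : ∀ {n} → (ℤ → ℕ) → Vec ℕ n → Vec ℤ n → ℕ
diagForm f []       []      = 0
diagForm f (c ∷ cs) (x ∷ v) = c * f x ℕ.+ diagForm f cs v

<-diagForm : ∀ {n m f} {cs : Vec ℕ n} {v} → All (0 <_) cs → Any (λ x → m < f x) v → m < diagForm f cs v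
<-diagForm {f = f} {c ∷ cs} {x ∷ v} (0<c ∷ _) (here m<fx) =
  ℕₚ.<-≤-trans m<fx (ℕₚ.≤-trans (ℕₚ.m≤n*m (f x) c {{ℕ.>-nonZero 0<c}}) (ℕₚ.m≤m+n _ _))
<-diagForm {cs = c ∷ cs} (_ ∷ 0<cs) (there m<) = ℕₚ.<-≤-trans (<-diagForm 0<cs m<) (ℕₚ.m≤n+m _ _)

diagForm-supported : ∀ {n k m f} {cs : Vec ℕ n} → All (0 <_) cs → (∀ x → k < ∣ x ∣ → m < f x) →
                     SupportedInBox k (λ v → 𝟙 (diagForm f cs v ℕ.≟ m))
diagForm-supported 0<cs big v outside =
  𝟙-no (_ ℕ.≟ _) (ℕₚ.>⇒≢ (<-diagForm 0<cs (Any.map (λ {x} → big x) outside)))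

sq : ℤ → ℕ
sq x = ∣ x ∣ * ∣ x ∣

pron : ℤ → ℕ
pron x = ∣ x ∣ * ∣ x - + 1 ∣

x*x≡+sq : ∀ x → x ℤ.* x ≡ + sq x
x*x≡+sq (+ n)    = sym (ℤₚ.pos-* n n)
x*x≡+sq -[1+ n ] = refl

x*[x-1]≡+pron : ∀ x → x ℤ.* (x - + 1) ≡ + pron x
x*[x-1]≡+pron (+ zero)  = refl
x*[x-1]≡+pron (+ suc k) = sym (ℤₚ.pos-* (suc k) k)
x*[x-1]≡+pron -[1+ k ]  = refl

sq-dbl : ∀ x → sq (dbl x) ≡ 4 * sq x
sq-dbl x = ℤₚ.+-injective (begin
  + sq (dbl x)        ≡⟨ sym (x*x≡+sq (dbl x)) ⟩
  dbl x ℤ.* dbl x     ≡⟨ expand x ⟩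
  + 4 ℤ.* (x ℤ.* x)   ≡⟨ cong (+ 4 ℤ.*_) (x*x≡+sq x) ⟩
  + 4 ℤ.* + sq x      ≡⟨ sym (ℤₚ.pos-* 4 (sq x)) ⟩
  + (4 * sq x)        ∎)
  where
  expand : ∀ x → (x + x) ℤ.* (x + x) ≡ + 4 ℤ.* (x ℤ.* x)
  expand = solve-∀

sq-dbl-1 : ∀ x → sq (dbl-1 x) ≡ 4 * pron x ℕ.+ 1
sq-dbl-1 x = ℤₚ.+-injective (begin
  + sq (dbl-1 x)                   ≡⟨ sym (x*x≡+sq (dbl-1 x)) ⟩
  dbl-1 x ℤ.* dbl-1 x              ≡⟨ expand x ⟩
  + 4 ℤ.* (x ℤ.* (x - + 1)) + + 1  ≡⟨ cong (λ z → + 4 ℤ.* z + + 1) (x*[x-1]≡+pron x) ⟩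
  + 4 ℤ.* + pron x + + 1           ≡⟨ cong (_+ + 1) (sym (ℤₚ.pos-* 4 (pron x))) ⟩
  + (4 * pron x) + + 1             ≡⟨ sym (ℤₚ.pos-+ (4 * pron x) 1) ⟩
  + (4 * pron x ℕ.+ 1)             ∎)
  where
  expand : ∀ x → (x + x - + 1) ℤ.* (x + x - + 1) ≡ + 4 ℤ.* (x ℤ.* (x - + 1)) + + 1
  expand = solve-∀

sq-big : ∀ {k} x → k < ∣ x ∣ → k < sq x
sq-big x k<∣x∣ = ℕₚ.<-≤-trans k<∣x∣ (ℕₚ.m≤m*n ∣ x ∣ ∣ x ∣ {{ℕ.≢-nonZero (ℕₚ.m<n⇒n≢0 k<∣x∣)}})

pron-big : ∀ {n} x → suc n < ∣ x ∣ → 2 * n < pron x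
pron-big (+ suc j)  (s≤s n<j) =
  ℕₚ.<-≤-trans (ℕₚ.*-monoʳ-< 2 n<j) (ℕₚ.*-monoˡ-≤ j (s≤s (ℕₚ.≤-<-trans z≤n n<j)))
pron-big -[1+ j ] (s≤s n<j) =
  ℕₚ.<-≤-trans (pron-big (+ suc j) (s≤s n<j)) (ℕₚ.*-monoʳ-≤ (suc j) (ℕₚ.≤-trans (ℕₚ.m≤m+n j 0) (ℕₚ.m≤n+m _ 2)))

diagForm-sq-dbl-1 : ∀ {n} (cs : Vec ℕ n) v →
                    diagForm sq cs (Vec.map dbl-1 v) ≡ 4 * diagForm pron cs v ℕ.+ Vec.sum cs
diagForm-sq-dbl-1 []       []      = refl
diagForm-sq-dbl-1 (c ∷ cs) (x ∷ v) = begin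
  c * sq (dbl-1 x) ℕ.+ diagForm sq cs (Vec.map dbl-1 v)
    ≡⟨ cong₂ (λ s r → c * s ℕ.+ r) (sq-dbl-1 x) (diagForm-sq-dbl-1 cs v) ⟩
  c * (4 * pron x ℕ.+ 1) ℕ.+ (4 * diagForm pron cs v ℕ.+ Vec.sum cs)
    ≡⟨ regroup c (pron x) (diagForm pron cs v) (Vec.sum cs) ⟩
  4 * (c * pron x ℕ.+ diagForm pron cs v) ℕ.+ (c ℕ.+ Vec.sum cs)
    ∎
  where
  regroup : ∀ c p f s → c * (4 * p ℕ.+ 1) ℕ.+ (4 * f ℕ.+ s) ≡ 4 * (c * p ℕ.+ f) ℕ.+ (c ℕ.+ s)
  regroup = ℕ-Solver.solve-∀

𝟙-pron≡𝟙-sq∘dbl-1 : ∀ {n} (cs : Vec ℕ n) {m M} → M ≡ 4 * m ℕ.+ Vec.sum cs → ∀ v →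
                    𝟙 (diagForm pron cs v ℕ.≟ m) ≡ 𝟙 (diagForm sq cs (Vec.map dbl-1 v) ℕ.≟ M)
𝟙-pron≡𝟙-sq∘dbl-1 cs {m} refl v =
  𝟙-⇔ (diagForm pron cs v ℕ.≟ m) (diagForm sq cs (Vec.map dbl-1 v) ℕ.≟ 4 * m ℕ.+ Vec.sum cs) (mk⇔
  (λ eq → trans (diagForm-sq-dbl-1 cs v) (cong (λ z → 4 * z ℕ.+ Vec.sum cs) eq))
  (λ eq → ℕₚ.*-cancelˡ-≡ _ _ 4 (ℕₚ.+-cancelʳ-≡ (Vec.sum cs) _ _ (trans (sym (diagForm-sq-dbl-1 cs v)) eq))))

quadrupleWhere : ∀ {n} → Vec Bool n → Vec ℕ n → Vec ℕ n
quadrupleWhere = zipWith (λ e c → if e then 4 * c else c)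

diagForm-sq-dblWhere : ∀ {n} (e : Vec Bool n) cs v →
                       diagForm sq cs (dblWhere e v) ≡ diagForm sq (quadrupleWhere e cs) v
diagForm-sq-dblWhere []          []       []      = refl
diagForm-sq-dblWhere (false ∷ e) (c ∷ cs) (x ∷ v) = cong (c * sq x ℕ.+_) (diagForm-sq-dblWhere e cs v)
diagForm-sq-dblWhere (true ∷ e)  (c ∷ cs) (x ∷ v) = cong₂ ℕ._+_ c*sq[2x]≡4c*sq[x] (diagForm-sq-dblWhere e cs v)
  where
  c*sq[2x]≡4c*sq[x] : c * sq (dbl x) ≡ 4 * c * sq x
  c*sq[2x]≡4c*sq[x] = trans (cong (c *_) (sq-dbl x))
                     (trans (sym (ℕₚ.*-assoc c 4 (sq x))) (cong (_* sq x) (ℕₚ.*-comm c 4)))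

toTuple : Vec ℤ 4 → ℤ × ℤ × ℤ × ℤ
toTuple (x ∷ y ∷ z ∷ w ∷ []) = x , y , z , w

∑-box4 : ∀ k (F : ℤ × ℤ × ℤ × ℤ → ℤ) → ∑ (box4 k) F ≡ boxSum 4 k (F ∘ toTuple)
∑-box4 k F =
  trans (∑-concatMap-range _) (symSum-cong k λ x →
  trans (∑-concatMap-range _) (symSum-cong k λ y →
  trans (∑-concatMap-range _) (symSum-cong k λ z →
  trans (∑-map _ (range k) F) (∑-range k _))))
  where
  ∑-concatMap-range : (g : ℤ → List (ℤ × ℤ × ℤ × ℤ)) →
                      ∑ (concatMap g (range k)) F ≡ symSum k (λ x → ∑ (g x) F)
  ∑-concatMap-range g = trans (∑-concatMap g (range k) F) (∑-range k _)

count-box4 : ∀ k {P : ℤ × ℤ × ℤ × ℤ → Set} (P? : Decidable P) →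
             + List.length (List.filter P? (box4 k)) ≡ boxSum 4 k (𝟙 ∘ P? ∘ toTuple)
count-box4 k P? = trans (length-filter≡∑𝟙 P? (box4 k)) (∑-box4 k (𝟙 ∘ P?))

diagonal4≡diagForm : ∀ {f : ℤ → ℤ} {g : ℤ → ℕ} → (∀ x → f x ≡ + g x) → ∀ p q r s x y z w →
  + p ℤ.* f x + + q ℤ.* f y + + r ℤ.* f z + + s ℤ.* f w ≡ + diagForm g (p ∷ q ∷ r ∷ s ∷ []) (x ∷ y ∷ z ∷ w ∷ [])
diagonal4≡diagForm {f} {g} f≡+g p q r s x y z w = begin
  P + Q + R + S
    ≡⟨ regroup P Q R S ⟩
  P + (Q + (R + (S + 0ℤ)))
    ≡⟨ cong (λ z → P + (Q + (R + z))) (sym (term s w [] [])) ⟩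
  P + (Q + (R + + diagForm g (s ∷ []) (w ∷ [])))
    ≡⟨ cong (λ z → P + (Q + z)) (sym (term r z (s ∷ []) (w ∷ []))) ⟩
  P + (Q + + diagForm g (r ∷ s ∷ []) (z ∷ w ∷ []))
    ≡⟨ cong (_+_ P) (sym (term q y (r ∷ s ∷ []) (z ∷ w ∷ []))) ⟩
  P + + diagForm g (q ∷ r ∷ s ∷ []) (y ∷ z ∷ w ∷ [])
    ≡⟨ sym (term p x (q ∷ r ∷ s ∷ []) (y ∷ z ∷ w ∷ [])) ⟩
  + diagForm g (p ∷ q ∷ r ∷ s ∷ []) (x ∷ y ∷ z ∷ w ∷ [])
    ∎
  where
  P = + p ℤ.* f x
  Q = + q ℤ.* f y
  R = + r ℤ.* f z
  S = + s ℤ.* f w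
  term : ∀ {n} c u (cs : Vec ℕ n) v → + diagForm g (c ∷ cs) (u ∷ v) ≡ + c ℤ.* f u + + diagForm g cs v
  term c u cs v = trans (ℤₚ.pos-+ (c * g u) _)
                        (cong (_+ _) (trans (ℤₚ.pos-* c (g u)) (cong (+ c ℤ.*_) (sym (f≡+g u)))))
  regroup : ∀ a b c d → a + b + c + d ≡ a + (b + (c + (d + 0ℤ)))
  regroup = solve-∀

uncurry⁴ : {A B : Set} → (A → A → A → A → B) → Vec A 4 → B
uncurry⁴ F (p ∷ q ∷ r ∷ s ∷ []) = F p q r s

alternatingSum-quadrupleWhere : (F : ℕ → ℕ → ℕ → ℕ → ℤ) (a b c d : ℕ) →
  alternatingSum 4 (λ e → uncurry⁴ F (quadrupleWhere e (a ∷ b ∷ c ∷ d ∷ []))) ≡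
    F a b c d - F a b c (4 * d) - F a b (4 * c) d + F a b (4 * c) (4 * d)
    - F a (4 * b) c d + F a (4 * b) c (4 * d) + F a (4 * b) (4 * c) d - F a (4 * b) (4 * c) (4 * d)
    - F (4 * a) b c d + F (4 * a) b c (4 * d) + F (4 * a) b (4 * c) d - F (4 * a) b (4 * c) (4 * d)
    + F (4 * a) (4 * b) c d - F (4 * a) (4 * b) c (4 * d) - F (4 * a) (4 * b) (4 * c) d
    + F (4 * a) (4 * b) (4 * c) (4 * d)
alternatingSum-quadrupleWhere F a b c d =
  flatten (F a b c d) (F a b c (4 * d)) (F a b (4 * c) d) (F a b (4 * c) (4 * d))
          (F a (4 * b) c d) (F a (4 * b) c (4 * d)) (F a (4 * b) (4 * c) d) (F a (4 * b) (4 * c) (4 * d))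
          (F (4 * a) b c d) (F (4 * a) b c (4 * d)) (F (4 * a) b (4 * c) d) (F (4 * a) b (4 * c) (4 * d))
          (F (4 * a) (4 * b) c d) (F (4 * a) (4 * b) c (4 * d)) (F (4 * a) (4 * b) (4 * c) d)
          (F (4 * a) (4 * b) (4 * c) (4 * d))
  where
  flatten : ∀ v₁ v₂ v₃ v₄ v₅ v₆ v₇ v₈ v₉ v₁₀ v₁₁ v₁₂ v₁₃ v₁₄ v₁₅ v₁₆ →
    v₁ - v₂ - (v₃ - v₄) - (v₅ - v₆ - (v₇ - v₈)) - (v₉ - v₁₀ - (v₁₁ - v₁₂) - (v₁₃ - v₁₄ - (v₁₅ - v₁₆)))
    ≡ v₁ - v₂ - v₃ + v₄ - v₅ + v₆ + v₇ - v₈ - v₉ + v₁₀ + v₁₁ - v₁₂ + v₁₃ - v₁₄ - v₁₅ + v₁₆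
  flatten = solve-∀

N≡boxSum : ∀ cs m → + uncurry⁴ N cs m ≡ boxSum 4 m (λ v → 𝟙 (diagForm sq cs v ℕ.≟ m))
N≡boxSum cs@(p ∷ q ∷ r ∷ s ∷ []) m = trans (count-box4 m P?) (boxSum-cong 4 m pointwise)
  where
  P? = λ u → quadVal p q r s u ℤ.≟ + m
  pointwise : ∀ v → 𝟙 (P? (toTuple v)) ≡ 𝟙 (diagForm sq cs v ℕ.≟ m)
  pointwise (x ∷ y ∷ z ∷ w ∷ []) = 𝟙-≟-pos m (diagonal4≡diagForm x*x≡+sq p q r s x y z w)

N-quadrupleWhere≡boxSum : ∀ e cs m →
  + uncurry⁴ N (quadrupleWhere e cs) m ≡ boxSum 4 m (λ v → 𝟙 (diagForm sq cs (dblWhere e v) ℕ.≟ m))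
N-quadrupleWhere≡boxSum e cs m = trans (N≡boxSum (quadrupleWhere e cs) m)
  (boxSum-cong 4 m (λ v → cong (λ k → 𝟙 (k ℕ.≟ m)) (sym (diagForm-sq-dblWhere e cs v))))

t≡boxSum : ∀ a b c d n →
           + t a b c d n ≡ boxSum 4 (suc n) (λ v → 𝟙 (diagForm pron (a ∷ b ∷ c ∷ d ∷ []) v ℕ.≟ 2 * n))
t≡boxSum a b c d n = trans (count-box4 (suc n) P?) (boxSum-cong 4 (suc n) pointwise)
  where
  P? = λ u → twiceTriVal a b c d u ℤ.≟ + (2 * n)
  pointwise : ∀ v → 𝟙 (P? (toTuple v)) ≡ 𝟙 (diagForm pron (a ∷ b ∷ c ∷ d ∷ []) v ℕ.≟ 2 * n)
  pointwise (x ∷ y ∷ z ∷ w ∷ []) = 𝟙-≟-pos (2 * n) (diagonal4≡diagForm x*[x-1]≡+pron a b c d x y z w)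

lemma3p1 : (a b c d n : ℕ) → .{{NonZero a}} → .{{NonZero b}} → .{{NonZero c}} → .{{NonZero d}} →
  let M = 8 * n ℕ.+ a ℕ.+ b ℕ.+ c ℕ.+ d
      NN : ℕ → ℕ → ℕ → ℕ → ℤ
      NN p q r s = + N p q r s M
  in + t a b c d n ≡
    NN a b c d - NN a b c (4 * d) - NN a b (4 * c) d + NN a b (4 * c) (4 * d)
    - NN a (4 * b) c d + NN a (4 * b) c (4 * d) + NN a (4 * b) (4 * c) d - NN a (4 * b) (4 * c) (4 * d)
    - NN (4 * a) b c d + NN (4 * a) b c (4 * d) + NN (4 * a) b (4 * c) d - NN (4 * a) b (4 * c) (4 * d)
    + NN (4 * a) (4 * b) c d - NN (4 * a) (4 * b) c (4 * d) - NN (4 * a) (4 * b) (4 * c) d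
    + NN (4 * a) (4 * b) (4 * c) (4 * d)
lemma3p1 a b c d n = begin
  + t a b c d n
    ≡⟨ t≡boxSum a b c d n ⟩
  boxSum 4 (suc n) T
    ≡⟨ sym (boxSum-extend 4 (diagForm-supported 0<abcd (pron-big {n})) 1+n≤M) ⟩
  boxSum 4 M T
    ≡⟨ boxSum-cong 4 M (𝟙-pron≡𝟙-sq∘dbl-1 abcd M≡4[2n]+∑abcd) ⟩
  boxSum 4 M (Q ∘ Vec.map dbl-1)
    ≡⟨ boxSum-dbl-1 4 (diagForm-supported 0<abcd (sq-big {M})) ⟩
  alternatingSum 4 (λ e → boxSum 4 M (Q ∘ dblWhere e))
    ≡⟨ alternatingSum-cong 4 (λ e → sym (N-quadrupleWhere≡boxSum e abcd M)) ⟩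
  alternatingSum 4 (λ e → + uncurry⁴ N (quadrupleWhere e abcd) M)
    ≡⟨ alternatingSum-quadrupleWhere (λ p q r s → + N p q r s M) a b c d ⟩
  _ ∎
  where
  abcd = a ∷ b ∷ c ∷ d ∷ []
  M = 8 * n ℕ.+ a ℕ.+ b ℕ.+ c ℕ.+ d
  T Q : Vec ℤ 4 → ℤ
  T v = 𝟙 (diagForm pron abcd v ℕ.≟ 2 * n)
  Q v = 𝟙 (diagForm sq abcd v ℕ.≟ M)
  0<abcd : All (0 <_) abcd
  0<abcd = ℕ.>-nonZero⁻¹ a ∷ ℕ.>-nonZero⁻¹ b ∷ ℕ.>-nonZero⁻¹ c ∷ ℕ.>-nonZero⁻¹ d ∷ []
  1+n≤M : suc n ≤ M
  1+n≤M = ℕₚ.≤-trans (ℕₚ.≤-reflexive (ℕₚ.+-comm 1 n))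
          (ℕₚ.≤-trans (ℕₚ.+-mono-≤ (ℕₚ.m≤n*m n 8) (ℕ.>-nonZero⁻¹ a))
          (ℕₚ.≤-trans (ℕₚ.m≤m+n _ b) (ℕₚ.≤-trans (ℕₚ.m≤m+n _ c) (ℕₚ.m≤m+n _ d))))
  M≡4[2n]+∑abcd : M ≡ 4 * (2 * n) ℕ.+ Vec.sum abcd
  M≡4[2n]+∑abcd = regroup n a b c d
    where
    regroup : ∀ n a b c d → 8 * n ℕ.+ a ℕ.+ b ℕ.+ c ℕ.+ d ≡ 4 * (2 * n) ℕ.+ (a ℕ.+ (b ℕ.+ (c ℕ.+ (d ℕ.+ 0))))
    regroup = ℕ-Solver.solve-∀
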